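{- Let $A_1,A_2\subseteq\mathbb{N}$ each satisfy conditions (i), (ii), (iii), and let $X=A_1\times A_2$. Let $p_1,p_2\in\mathbb{N}$, write $rank(p_1)=rank_{A_1}(p_1)$ and $rank(p_2)=rank_{A_2}(p_2)$, and let $L=\min\{rank(p_1),rank(p_2)\}$. Suppose there exist a shortest representation $\varepsilon_1$ of $p_1$ from $A_1$ and a shortest representation $\varepsilon_2$ of $p_2$ from $A_2$ such that $$K:=\max\{mult(p_1,\varepsilon_1),\ mult(p_2,\varepsilon_2),\ |rank(p_1)-rank(p_2)|\}\le \frac{\sqrt{L}}{2}.$$ Then $(p_1,p_2)\in FS(X)$.
   Context: $\mathbb{N}=\{1,2,3,\dots\}$. For a set $A=\{a_1<a_2<\dots\}\subseteq\mathbb{N}$ the conditions are: (i) $1\in A$; (ii) $A\setminus\{1\}\subseteq A+A$, where $A+A=\{a+b:a,b\in A\}$; (iii) $a_{j+1}>\varrho a_j$ for all $j$, for some fixed $\varrho\in(1,2]$. A representation $\varepsilon$ of $n\in\mathbb{N}$ from $A$ is an expression $n=\sum_i\varepsilon_i a_i$ with nonnegative integer coefficients, finitely many nonzero (repetitions allowed); its length is $\sum_i\varepsilon_i$ and $mult(n,\varepsilon)=\max_i\varepsilon_i$. $rank_A(n)$ is the minimal length of a representation of $n$ from $A$; a shortest representation is one of length $rank_A(n)$. For $X\subseteq\mathbb{N}^2$, $FS(X)$ is the set of all sums $\sum_{x\in F}x$ over nonempty finite subsets $F\subseteq X$ (distinct elements, each used at most once). -}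

module Defs where

open import Data.Nat using (ℕ; zero; suc; _+_; _*_; _≤_; _<_; _⊔_; _⊓_; ∣_-_∣; _≟_)
open import Data.Product using (Σ; ∃; ∃-syntax; _×_; _,_)
open import Data.List using (List; []; _∷_; length; map)
open import Data.Nat.ListAction using (sum)
open import Data.List.Relation.Unary.All using (All)
open import Data.List.Relation.Unary.Unique.Propositional using (Unique)
open import Relation.Binary.PropositionalEquality using (_≡_; _≢_)
open import Relation.Nullary using (yes; no)

-- A subset of ℕ = {1,2,3,...} is a predicate on Agda's ℕ whose members are all ≥ 1.
Subset : Set₁
Subset = ℕ → Set

-- Conditions (i), (ii), (iii) (together with A ⊆ {1,2,...}).
-- (iii) with a real ϱ ∈ (1,2] is stated with a rational ϱ = p / q, q < p ≤ 2q:
-- consecutive elements x < y of A (no element of A strictly between) satisfy y > ϱ x.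
record Admissible (A : Subset) : Set where
  field
    positive : ∀ n → A n → 1 ≤ n
    cond-i   : A 1
    cond-ii  : ∀ n → A n → n ≢ 1 → ∃[ a ] ∃[ b ] (A a × A b × n ≡ a + b)
    cond-iii : ∃[ p ] ∃[ q ] (q < p × p ≤ 2 * q ×
                 (∀ x y → A x → A y → x < y → (∀ z → A z → x < z → y ≤ z) →
                   p * x < q * y))

-- A representation of n from A: a finite multiset of elements of A (a list,
-- repetitions allowed, order irrelevant) summing to n.  ε_a = number of occurrences of a.
IsRep : Subset → ℕ → List ℕ → Set
IsRep A n ε = All A ε × sum ε ≡ n

repLength : List ℕ → ℕ
repLength = length

occ : ℕ → List ℕ → ℕ
occ x [] = 0
occ x (y ∷ ys) with x ≟ y
... | yes _ = suc (occ x ys)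
... | no  _ = occ x ys

mult : List ℕ → ℕ
mult ε = go ε
  where
  go : List ℕ → ℕ
  go [] = 0
  go (y ∷ ys) = occ y ε ⊔ go ys

IsShortestRep : Subset → ℕ → List ℕ → Set
IsShortestRep A n ε = IsRep A n ε × (∀ δ → IsRep A n δ → repLength ε ≤ repLength δ)

_×ˢ_ : Subset → Subset → (ℕ × ℕ → Set)
(A₁ ×ˢ A₂) (a , b) = A₁ a × A₂ b

sum² : List (ℕ × ℕ) → ℕ × ℕ
sum² [] = 0 , 0
sum² ((a , b) ∷ xs) with sum² xs
... | (s , t) = a + s , b + t

FS : (ℕ × ℕ → Set) → (ℕ × ℕ → Set)
FS X v = ∃[ F ] (All X F × Unique F × 1 ≤ length F × sum² F ≡ v)

-- Lengthen the shorter representation to the length n of the longer one by repeatedly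
-- replacing a summand a ≠ 1 by two summands b + c = a from A (condition (ii)); at most K
-- summands equal 1, so this is possible, and each value's multiplicity grows by at most 2 per
-- step. The two lists then have length n ≥ 4K² ≥ K(3K + 1), with multiplicities at most 3K and K.
--
-- Sort both lists and lay the positions 0, …, n − 1 out in a grid with K columns of height q or
-- q + 1, where q > 3K. Each cell is labelled by the x at its column-major position and the y at
-- its row-major position. Equal entries of a sorted list with multiplicities ≤ B sit fewer than B
-- positions apart, so two distinct cells with the same y lie in different columns and in rows at most one
-- apart; their column-major positions then differ by at least q − 1 ≥ 3K, so their x differ.
-- Hence the labels form a set of distinct pairs witnessing the sum (p₁, p₂).

module Submission where

open import Defs
open import Data.Nat using (ℕ; _+_; _*_; _≤_; _⊔_; _⊓_; ∣_-_∣)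
open import Data.List using (List)
open import Data.Product using (_×_; _,_)

open import Data.Empty using (⊥-elim)
open import Data.List using ([]; _∷_; [_]; _++_; length; map; concatMap)
open import Data.List.Properties
  using (length-map; ++-assoc; ++-identityʳ; map-++; map-∘; map-concatMap; concatMap-cong; concatMap-++)
open import Data.List.Relation.Binary.Permutation.Propositional using (_↭_; ↭-sym)
import Data.List.Relation.Binary.Permutation.Propositional as ↭
import Data.List.Relation.Binary.Permutation.Propositional.Properties as ↭
open import Data.List.Relation.Unary.All using (All; []; _∷_)
import Data.List.Relation.Unary.All as All
import Data.List.Relation.Unary.All.Properties as All
open import Data.List.Relation.Unary.AllPairs using (AllPairs; []; _∷_)
open import Data.List.Relation.Unary.Linked.Properties using (Linked⇒AllPairs)
open import Data.List.Relation.Unary.Unique.Propositional using (Unique)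
import Data.List.Relation.Unary.Unique.Propositional.Properties as Unique
open import Data.Nat
  using (zero; suc; _∸_; _<_; _≟_; _≤?_; z≤n; s≤s; z<s; s<s; NonZero; >-nonZero; >-nonZero⁻¹; _/_; _%_)
open import Data.Nat.DivMod using (m≡m%n+[m/n]*n; m%n<n)
open import Data.Nat.ListAction using (sum)
open import Data.Nat.ListAction.Properties using (sum-↭)
open import Data.Nat.Properties
open import Data.List.Sort ≤-decTotalOrder using (sort; sort-↭; sort-↗)
open import Algebra.Properties.CommutativeSemigroup +-commutativeSemigroup using (x∙yz≈y∙xz)
open import Data.Nat.Solver using (module +-*-Solver)
open import Data.Product using (∃-syntax; proj₁; proj₂; swap)
open import Data.Sum using (inj₁; inj₂; [_,_]′)
open import Function using (_∘_)
open import Relation.Binary.Definitions using (tri<; tri≈; tri>)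
open import Relation.Binary.PropositionalEquality hiding ([_])
open import Relation.Nullary using (yes; no)

occ-∷ : ∀ v x xs → occ v (x ∷ xs) ≡ occ v [ x ] + occ v xs
occ-∷ v x xs with v ≟ x
... | yes _ = refl
... | no  _ = refl

occ-↭ : ∀ v {xs ys} → xs ↭ ys → occ v xs ≡ occ v ys
occ-↭ v ↭.refl = refl
occ-↭ v {x ∷ xs} {x ∷ ys} (↭.prep x p) = begin
  occ v (x ∷ xs)         ≡⟨ occ-∷ v x xs ⟩
  occ v [ x ] + occ v xs ≡⟨ cong (occ v [ x ] +_) (occ-↭ v p) ⟩
  occ v [ x ] + occ v ys ≡⟨ occ-∷ v x ys ⟨
  occ v (x ∷ ys)         ∎
  where open ≡-Reasoning
occ-↭ v {x ∷ y ∷ xs} {y ∷ x ∷ ys} (↭.swap x y p) = begin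
  occ v (x ∷ y ∷ xs)                     ≡⟨ occ-∷∷ x y xs ⟩
  occ v [ x ] + (occ v [ y ] + occ v xs) ≡⟨ cong (λ n → occ v [ x ] + (occ v [ y ] + n)) (occ-↭ v p) ⟩
  occ v [ x ] + (occ v [ y ] + occ v ys) ≡⟨ x∙yz≈y∙xz (occ v [ x ]) (occ v [ y ]) (occ v ys) ⟩
  occ v [ y ] + (occ v [ x ] + occ v ys) ≡⟨ occ-∷∷ y x ys ⟨
  occ v (y ∷ x ∷ ys)                     ∎
  where
  open ≡-Reasoning
  occ-∷∷ : ∀ a b zs → occ v (a ∷ b ∷ zs) ≡ occ v [ a ] + (occ v [ b ] + occ v zs)
  occ-∷∷ a b zs = trans (occ-∷ v a (b ∷ zs)) (cong (occ v [ a ] +_) (occ-∷ v b zs))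
occ-↭ v (↭.trans p q) = trans (occ-↭ v p) (occ-↭ v q)

occ-∷-≤ : ∀ v x xs → occ v (x ∷ xs) ≤ suc (occ v xs)
occ-∷-≤ v x xs with v ≟ x
... | yes _ = ≤-refl
... | no  _ = n≤1+n _

occ-≤-∷ : ∀ v x xs → occ v xs ≤ occ v (x ∷ xs)
occ-≤-∷ v x xs with v ≟ x
... | yes _ = n≤1+n _
... | no  _ = ≤-refl

-- `mult ε` unfolds to `go ε ε` for a helper `go` local to `Defs.mult`, which cannot be named
-- from here. `multOver` is that helper: its body is the meta solved by `mult-∷`, whose `with`
-- generalises `y ∷ ys` so that the resulting constraint is a pattern.
mutual
  multOver : List ℕ → List ℕ → ℕ
  multOver = _

  mult-∷ : ∀ y ys → mult (y ∷ ys) ≡ occ y (y ∷ ys) ⊔ multOver (y ∷ ys) ys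
  mult-∷ y ys with y ∷ ys
  ... | ε = refl

occ≤multOver : ∀ ε v w → 0 < occ v w → occ v ε ≤ multOver ε w
occ≤multOver ε v (y ∷ ys) h with v ≟ y
... | yes refl = m≤m⊔n (occ v ε) (multOver ε ys)
... | no  _    = ≤-trans (occ≤multOver ε v ys h) (m≤n⊔m (occ y ε) (multOver ε ys))

occ≤mult : ∀ v ε → occ v ε ≤ mult ε
occ≤mult v ε with occ v ε in eq
... | zero  = z≤n
... | suc _ = subst (_≤ multOver ε ε) eq (occ≤multOver ε v ε (subst (0 <_) (sym eq) z<s))

mult-pos : ∀ {ε} → 0 < sum ε → 0 < mult ε
mult-pos {y ∷ ys} _ = ≤-trans occ-head (occ≤mult y (y ∷ ys))
  where
  occ-head : 1 ≤ occ y (y ∷ ys)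
  occ-head with y ≟ y
  ... | yes _   = s≤s z≤n
  ... | no  y≢y = ⊥-elim (y≢y refl)

-- Lengthening a representation

slack-after-split : ∀ {a a′ l l′} d → a′ ≤ 2 + a → l′ ≡ suc l → a + suc d ≤ l → a′ + d ≤ l′
slack-after-split {a} {a′} {l} {l′} d a′≤ refl h = begin
  a′ + d          ≤⟨ +-monoˡ-≤ d a′≤ ⟩
  2 + a + d       ≡⟨ cong suc (+-suc a d) ⟨
  suc (a + suc d) ≤⟨ s≤s h ⟩
  suc l           ∎
  where open ≤-Reasoning

2*-suc-bound : ∀ d {x y} → x ≤ 2 + y → 2 * d + x ≤ 2 * suc d + y
2*-suc-bound d {x} {y} x≤ = begin
  2 * d + x       ≤⟨ +-monoʳ-≤ (2 * d) x≤ ⟩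
  2 * d + (2 + y) ≡⟨ x∙yz≈y∙xz (2 * d) 2 y ⟩
  2 + (2 * d + y) ≡⟨ +-assoc 2 (2 * d) y ⟨
  2 + 2 * d + y   ≡⟨ cong (_+ y) (*-suc 2 d) ⟨
  2 * suc d + y   ∎
  where open ≤-Reasoning

module Lengthen {A : Subset}
  (split : ∀ n → A n → n ≢ 1 → ∃[ a ] ∃[ b ] (A a × A b × n ≡ a + b)) where

  extract-non1 : ∀ xs → occ 1 xs < length xs → ∃[ a ] ∃[ rest ] (a ≢ 1 × xs ↭ a ∷ rest)
  extract-non1 (y ∷ ys) h with 1 ≟ y
  ... | no 1≢y = y , ys , ≢-sym 1≢y , ↭.refl
  ... | yes refl with extract-non1 ys (≤-pred h)
  ...   | a , rest , a≢1 , ys↭ = a , 1 ∷ rest , a≢1 , ↭.trans (↭.prep 1 ys↭) (↭.swap 1 a ↭.refl)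

  split-once : ∀ xs → All A xs → occ 1 xs < length xs →
    ∃[ ys ] (All A ys × sum ys ≡ sum xs × length ys ≡ suc (length xs) ×
             (∀ v → occ v ys ≤ 2 + occ v xs))
  split-once xs Axs h with extract-non1 xs h
  ... | a , rest , a≢1 , xs↭ with ↭.All-resp-↭ xs↭ Axs
  ...   | Aa ∷ Arest with split a Aa a≢1
  ...     | b , c , Ab , Ac , refl =
    b ∷ c ∷ rest , Ab ∷ Ac ∷ Arest ,
    trans (sym (+-assoc b c (sum rest))) (sym (sum-↭ xs↭)) ,
    cong suc (sym (↭.↭-length xs↭)) ,
    occ-le
    where
    occ-le : ∀ v → occ v (b ∷ c ∷ rest) ≤ 2 + occ v xs
    occ-le v = begin
      occ v (b ∷ c ∷ rest)     ≤⟨ occ-∷-≤ v b (c ∷ rest) ⟩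
      suc (occ v (c ∷ rest))   ≤⟨ s≤s (occ-∷-≤ v c rest) ⟩
      2 + occ v rest           ≤⟨ +-monoʳ-≤ 2 (occ-≤-∷ v (b + c) rest) ⟩
      2 + occ v (b + c ∷ rest) ≡⟨ cong (2 +_) (occ-↭ v xs↭) ⟨
      2 + occ v xs             ∎
      where open ≤-Reasoning

  lengthen : ∀ d xs → All A xs → occ 1 xs + d ≤ length xs →
    ∃[ ys ] (All A ys × sum ys ≡ sum xs × length ys ≡ d + length xs ×
             (∀ v → occ v ys ≤ 2 * d + occ v xs))
  lengthen zero xs Axs _ = xs , Axs , refl , refl , λ _ → ≤-refl
  lengthen (suc d) xs Axs h
    with xs′ , Axs′ , sum′ , length′ , occ′ ← split-once xs Axs (<-≤-trans (m<m+n _ z<s) h)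
    with ys , Ays , sum″ , length″ , occ″ ← lengthen d xs′ Axs′ (slack-after-split d (occ′ 1) length′ h) =
    ys , Ays , trans sum″ sum′ , trans length″ (trans (cong (d +_) length′) (+-suc d _)) ,
    λ v → ≤-trans (occ″ v) (2*-suc-bound d (occ′ v))

range : ℕ → ℕ → List ℕ
range a zero    = []
range a (suc l) = a ∷ range (suc a) l

range-++ : ∀ a b c → range a (b + c) ≡ range a b ++ range (a + b) c
range-++ a zero    c = cong (λ x → range x c) (sym (+-identityʳ a))
range-++ a (suc b) c = cong (a ∷_) (trans (range-++ (suc a) b c) (cong (λ x → range (suc a) b ++ range x c) (sym (+-suc a b))))

range-∷ʳ : ∀ a l → range a (suc l) ≡ range a l ++ [ a + l ]
range-∷ʳ a l = trans (cong (range a) (+-comm 1 l)) (range-++ a l 1)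

map-+-range : ∀ k a l → map (k +_) (range a l) ≡ range (k + a) l
map-+-range k a zero    = refl
map-+-range k a (suc l) = cong ((k + a) ∷_) (trans (map-+-range k (suc a) l) (cong (λ x → range x l) (+-suc k a)))

range-All : ∀ {Q : ℕ → Set} a l → (∀ {c} → a ≤ c → c < a + l → Q c) → All Q (range a l)
range-All a zero    _ = []
range-All a (suc l) h =
  h ≤-refl (m<m+n a z<s) ∷ range-All (suc a) l (λ a<c c< → h (<⇒≤ a<c) (<-≤-trans c< (≤-reflexive (sym (+-suc a l)))))

range-unique : ∀ a l → Unique (range a l)
range-unique a zero    = []
range-unique a (suc l) = range-All (suc a) l (λ a<c _ → <⇒≢ a<c) ∷ range-unique (suc a) l

concatMap-cong-All : ∀ {A B : Set} {f g : A → List B} {xs} → All (λ x → f x ≡ g x) xs →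
  concatMap f xs ≡ concatMap g xs
concatMap-cong-All []         = refl
concatMap-cong-All (eq ∷ eqs) = cong₂ _++_ eq (concatMap-cong-All eqs)

map⁺-injectiveOn : ∀ {A B : Set} {P : A → Set} {f : A → B} {xs} → All P xs →
  (∀ {x y} → P x → P y → f x ≡ f y → x ≡ y) → Unique xs → Unique (map f xs)
map⁺-injectiveOn []         _   []           = []
map⁺-injectiveOn (px ∷ pxs) inj (x∉xs ∷ xs!) =
  All.map⁺ (All.zipWith (λ (py , x≢y) → x≢y ∘ inj px py) (pxs , x∉xs)) ∷ map⁺-injectiveOn pxs inj xs!

-- Runs of equal entries in sorted lists

Clustered : ℕ → ℕ → (ℕ → ℕ) → Set
Clustered n B X = ∀ {t t′} → t < t′ → t′ < n → X t ≡ X t′ → t′ < t + B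

nth : List ℕ → ℕ → ℕ
nth []       _       = 0
nth (x ∷ xs) zero    = x
nth (x ∷ xs) (suc i) = nth xs i

map-nth-range : ∀ xs → map (nth xs) (range 0 (length xs)) ≡ xs
map-nth-range []       = refl
map-nth-range (x ∷ xs) = cong (x ∷_) (trans (shift 0 (length xs)) (map-nth-range xs))
  where
  shift : ∀ a l → map (nth (x ∷ xs)) (range (suc a) l) ≡ map (nth xs) (range a l)
  shift a zero    = refl
  shift a (suc l) = cong (nth xs a ∷_) (shift (suc a) l)

All-nth : ∀ {P : ℕ → Set} {xs i} → All P xs → i < length xs → P (nth xs i)
All-nth {i = zero}  (px ∷ _)   _         = px
All-nth {i = suc i} (_  ∷ pxs) (s<s i<l) = All-nth pxs i<l

nth-mono : ∀ {xs i j} → AllPairs _≤_ xs → i ≤ j → j < length xs → nth xs i ≤ nth xs j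
nth-mono {_ ∷ _} {zero}  {zero}  _           _         _         = ≤-refl
nth-mono {_ ∷ _} {zero}  {suc j} (x≤ ∷ _)    _         (s<s j<l) = All-nth x≤ j<l
nth-mono {_ ∷ _} {suc i} {suc j} (_  ∷ xs↗) (s≤s i≤j) (s<s j<l) = nth-mono xs↗ i≤j j<l

run≤occ : ∀ xs {a b v} → (∀ {s} → a ≤ s → s ≤ b → nth xs s ≡ v) → b < length xs → suc b ≤ a + occ v xs
run≤occ (y ∷ ys) {zero} {zero} {v} run _ with v ≟ y
... | yes _   = s≤s z≤n
... | no  v≢y = ⊥-elim (v≢y (sym (run z≤n z≤n)))
run≤occ (y ∷ ys) {zero} {suc b} {v} run (s<s b<l) with v ≟ y
... | yes _   = s≤s (run≤occ ys (λ _ s≤b → run z≤n (s≤s s≤b)) b<l)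
... | no  v≢y = ⊥-elim (v≢y (sym (run z≤n z≤n)))
run≤occ (y ∷ ys) {suc a} {zero}  _   _         = s≤s z≤n
run≤occ (y ∷ ys) {suc a} {suc b} {v} run (s<s b<l) = begin
  suc (suc b)        ≤⟨ s≤s (run≤occ ys (λ a≤s s≤b → run (s≤s a≤s) (s≤s s≤b)) b<l) ⟩
  suc (a + occ v ys) ≤⟨ s≤s (+-monoʳ-≤ a (occ-≤-∷ v y ys)) ⟩
  suc a + occ v (y ∷ ys) ∎
  where open ≤-Reasoning

sorted-Clustered : ∀ {xs B} → AllPairs _≤_ xs → (∀ v → occ v xs ≤ B) → Clustered (length xs) B (nth xs)
sorted-Clustered {xs} {B} xs↗ occ≤B {t} {t′} t<t′ t′<l eq =
  ≤-trans (run≤occ xs run t′<l) (+-monoʳ-≤ t (occ≤B (nth xs t)))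
  where
  run : ∀ {s} → t ≤ s → s ≤ t′ → nth xs s ≡ nth xs t
  run t≤s s≤t′ = ≤-antisym (≤-trans (nth-mono xs↗ s≤t′ t′<l) (≤-reflexive (sym eq)))
                           (nth-mono xs↗ t≤s (≤-<-trans s≤t′ t′<l))

-- The transposition grid

𝟙[_<_] : ℕ → ℕ → ℕ
𝟙[ c     < zero  ] = 0
𝟙[ zero  < suc r ] = 1
𝟙[ suc c < suc r ] = 𝟙[ c < r ]

𝟙[r<r] : ∀ r → 𝟙[ r < r ] ≡ 0
𝟙[r<r] zero    = refl
𝟙[r<r] (suc r) = 𝟙[r<r] r

𝟙[r<1+r] : ∀ r → 𝟙[ r < suc r ] ≡ 1
𝟙[r<1+r] zero    = refl
𝟙[r<1+r] (suc r) = 𝟙[r<1+r] r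

𝟙[c<1+r] : ∀ {c r} → c ≢ r → 𝟙[ c < suc r ] ≡ 𝟙[ c < r ]
𝟙[c<1+r] {zero}  {zero}  c≢r = ⊥-elim (c≢r refl)
𝟙[c<1+r] {zero}  {suc r} _   = refl
𝟙[c<1+r] {suc c} {zero}  _   = refl
𝟙[c<1+r] {suc c} {suc r} c≢r = 𝟙[c<1+r] (c≢r ∘ cong suc)

𝟙[c<r] : ∀ {c r} → c < r → 𝟙[ c < r ] ≡ 1
𝟙[c<r] {zero}  {suc r} _         = refl
𝟙[c<r] {suc c} {suc r} (s<s c<r) = 𝟙[c<r] c<r

1+c⊓r : ∀ c r → suc c ⊓ r ≡ c ⊓ r + 𝟙[ c < r ]
1+c⊓r c       zero    = sym (cong (_+ 0) (⊓-zeroʳ c))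
1+c⊓r zero    (suc r) = refl
1+c⊓r (suc c) (suc r) = cong suc (1+c⊓r c r)

concatMap-extend : ∀ {A : Set} (cols cols′ : ℕ → List A) {r} {a : A} →
  cols′ r ≡ cols r ++ [ a ] → (∀ {c} → c ≢ r → cols′ c ≡ cols c) →
  ∀ b l → b ≤ r → r < b + l → concatMap cols′ (range b l) ↭ a ∷ concatMap cols (range b l)
concatMap-extend cols cols′ {r} {a} grow same = go
  where
  open ↭.PermutationReasoning
  after : ∀ b l → r < b → concatMap cols′ (range b l) ≡ concatMap cols (range b l)
  after b l r<b = concatMap-cong-All (range-All b l (λ b≤c _ → same (>⇒≢ (<-≤-trans r<b b≤c))))
  go : ∀ b l → b ≤ r → r < b + l → concatMap cols′ (range b l) ↭ a ∷ concatMap cols (range b l)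
  go b zero    b≤r r<b+0 = ⊥-elim (<⇒≱ r<b+0 (≤-trans (≤-reflexive (+-identityʳ b)) b≤r))
  go b (suc l) b≤r r<b+l with b ≟ r
  ... | yes refl = begin
    cols′ b ++ concatMap cols′ (range (suc b) l) ≡⟨ cong₂ _++_ grow (after (suc b) l ≤-refl) ⟩
    (cols b ++ [ a ]) ++ rest                    ≡⟨ ++-assoc (cols b) [ a ] rest ⟩
    cols b ++ [ a ] ++ rest                      ↭⟨ ↭.shift a (cols b) rest ⟩
    a ∷ cols b ++ rest                           ∎
    where rest = concatMap cols (range (suc b) l)
  ... | no b≢r = begin
    cols′ b ++ concatMap cols′ (range (suc b) l) ≡⟨ cong (_++ _) (same b≢r) ⟩
    cols b ++ concatMap cols′ (range (suc b) l)  ↭⟨ ↭.++⁺ˡ (cols b) (go (suc b) l (≤∧≢⇒< b≤r b≢r) r<1+b+l) ⟩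
    cols b ++ a ∷ rest                           ↭⟨ ↭.shift a (cols b) rest ⟩
    a ∷ cols b ++ rest                           ∎
    where
    rest = concatMap cols (range (suc b) l)
    r<1+b+l : r < suc b + l
    r<1+b+l = <-≤-trans r<b+l (≤-reflexive (+-suc b l))

-- `column q r c` lists the row-major indices in column c of the m-column grid with q * m + r
-- cells; adding the cell q * m + r only extends column r, which drives the induction.
module RowMajor (m : ℕ) where

  column : ℕ → ℕ → ℕ → List ℕ
  column q r c = map (λ k → c + k * m) (range 0 (q + 𝟙[ c < r ]))

  column-grow : ∀ q r → column q (suc r) r ≡ column q r r ++ [ r + q * m ]
  column-grow q r = begin
    map f (range 0 (q + 𝟙[ r < suc r ])) ≡⟨ cong (λ x → map f (range 0 (q + x))) (𝟙[r<1+r] r) ⟩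
    map f (range 0 (q + 1))              ≡⟨ cong (map f) (trans (cong (range 0) (+-comm q 1)) (range-∷ʳ 0 q)) ⟩
    map f (range 0 q ++ [ q ])           ≡⟨ map-++ f (range 0 q) [ q ] ⟩
    map f (range 0 q) ++ [ r + q * m ]   ≡⟨ cong (λ x → map f (range 0 x) ++ [ r + q * m ]) q+0≡q ⟨
    map f (range 0 (q + 𝟙[ r < r ])) ++ [ r + q * m ] ∎
    where
    open ≡-Reasoning
    f = λ k → r + k * m
    q+0≡q = trans (cong (q +_) (𝟙[r<r] r)) (+-identityʳ q)

  column-same : ∀ q {r c} → c ≢ r → column q (suc r) c ≡ column q r c
  column-same q {c = c} c≢r = cong (λ x → map (λ k → c + k * m) (range 0 (q + x))) (𝟙[c<1+r] c≢r)

  rowMajor-↭ : ∀ q r → r ≤ m → concatMap (column q r) (range 0 m) ↭ range 0 (q * m + r)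
  rowMajor-↭ zero zero _ = ↭.↭-reflexive (empty (range 0 m))
    where
    empty : ∀ cs → concatMap (column 0 0) cs ≡ []
    empty []       = refl
    empty (_ ∷ cs) = empty cs
  rowMajor-↭ (suc q) zero _ = begin
    concatMap (column (suc q) 0) (range 0 m) ≡⟨ concatMap-cong-All (range-All 0 m full-row) ⟩
    concatMap (column q m) (range 0 m)       ↭⟨ rowMajor-↭ q m ≤-refl ⟩
    range 0 (q * m + m)                      ≡⟨ cong (range 0) (trans (+-comm (q * m) m) (sym (+-identityʳ _))) ⟩
    range 0 (suc q * m + 0)                  ∎
    where
    open ↭.PermutationReasoning
    full-row : ∀ {c} → 0 ≤ c → c < 0 + m → column (suc q) 0 c ≡ column q m c
    full-row {c} _ c<m = cong (λ x → map (λ k → c + k * m) (range 0 x))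
      (trans (+-identityʳ (suc q)) (trans (+-comm 1 q) (cong (q +_) (sym (𝟙[c<r] c<m)))))
  rowMajor-↭ q (suc r) r<m = begin
    concatMap (column q (suc r)) (range 0 m)     ↭⟨ concatMap-extend (column q r) (column q (suc r))
                                                      (column-grow q r) (column-same q) 0 m z≤n r<m ⟩
    (r + q * m) ∷ concatMap (column q r) (range 0 m) <⟨ rowMajor-↭ q r (<⇒≤ r<m) ⟩
    (r + q * m) ∷ range 0 (q * m + r)                ↭⟨ ↭.∷↭∷ʳ (r + q * m) (range 0 (q * m + r)) ⟩
    range 0 (q * m + r) ++ [ r + q * m ]             ≡⟨ cong (λ x → range 0 (q * m + r) ++ [ x ]) (+-comm r (q * m)) ⟩
    range 0 (q * m + r) ++ [ q * m + r ]             ≡⟨ range-∷ʳ 0 (q * m + r) ⟨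
    range 0 (suc (q * m + r))                        ≡⟨ cong (range 0) (+-suc (q * m) r) ⟨
    range 0 (q * m + suc r)                          ∎
    where open ↭.PermutationReasoning

module Grid (m q r : ℕ) (r≤m : r ≤ m) where

  n : ℕ
  n = q * m + r

  height : ℕ → ℕ
  height c = q + 𝟙[ c < r ]

  -- the columns before c hold q cells each, plus one more for each of the first c ⊓ r of them
  colStart : ℕ → ℕ
  colStart c = q * c + c ⊓ r

  column : ℕ → List (ℕ × ℕ)
  column c = map (c ,_) (range 0 (height c))

  cells : List (ℕ × ℕ)
  cells = concatMap column (range 0 m)

  colMajor : ℕ × ℕ → ℕ
  colMajor (c , k) = colStart c + k

  rowMajor : ℕ × ℕ → ℕ
  rowMajor (c , k) = c + k * m

  Cell : ℕ × ℕ → Set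
  Cell (c , k) = c < m × k < height c

  colStart-suc : ∀ c → colStart (suc c) ≡ colStart c + height c
  colStart-suc c = begin
    q * suc c + suc c ⊓ r            ≡⟨ cong₂ _+_ (*-suc q c) (1+c⊓r c r) ⟩
    q + q * c + (c ⊓ r + 𝟙[ c < r ]) ≡⟨ solve 4 (λ a b x y → (a :+ b) :+ (x :+ y) := (b :+ x) :+ (a :+ y))
                                              refl q (q * c) (c ⊓ r) 𝟙[ c < r ] ⟩
    q * c + c ⊓ r + (q + 𝟙[ c < r ])     ∎
    where
    open ≡-Reasoning
    open +-*-Solver

  colStart-mono : ∀ {c c′} → c ≤ c′ → colStart c ≤ colStart c′
  colStart-mono {c′ = zero} z≤n = ≤-refl
  colStart-mono {c} {suc c′} c≤1+c′ with m≤n⇒m<n∨m≡n c≤1+c′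
  ... | inj₁ c<1+c′ = ≤-trans (colStart-mono (≤-pred c<1+c′))
                               (≤-trans (m≤m+n (colStart c′) (height c′)) (≤-reflexive (sym (colStart-suc c′))))
  ... | inj₂ refl   = ≤-refl

  colStart-< : ∀ {c c′} → c < c′ → colStart c + height c ≤ colStart c′
  colStart-< {c} {c′} c<c′ = subst (_≤ colStart c′) (colStart-suc c) (colStart-mono c<c′)

  cells-Cell : All Cell cells
  cells-Cell = All.concat⁺ (All.map⁺ (range-All 0 m λ {c} _ c<m →
                 All.map⁺ (range-All 0 (height c) λ _ k<h → c<m , k<h)))

  colMajor-cells : map colMajor cells ≡ range 0 n
  colMajor-cells = begin
    map colMajor cells                                          ≡⟨ map-concatMap colMajor column (range 0 m) ⟩
    concatMap (map colMajor ∘ column) (range 0 m)               ≡⟨ concatMap-cong column-ranges (range 0 m) ⟩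
    concatMap (λ c → range (colStart c) (height c)) (range 0 m) ≡⟨ concat-ranges m ⟩
    range 0 (colStart m)                                        ≡⟨ cong (λ x → range 0 (q * m + x)) (m≥n⇒m⊓n≡n r≤m) ⟩
    range 0 n                                                   ∎
    where
    open ≡-Reasoning
    column-ranges : ∀ c → map colMajor (column c) ≡ range (colStart c) (height c)
    column-ranges c = trans (sym (map-∘ (range 0 (height c))))
      (trans (map-+-range (colStart c) 0 (height c)) (cong (λ x → range x (height c)) (+-identityʳ (colStart c))))
    concat-ranges : ∀ l → concatMap (λ c → range (colStart c) (height c)) (range 0 l) ≡ range 0 (colStart l)
    concat-ranges zero    = cong (range 0) (sym (trans (+-identityʳ (q * 0)) (*-zeroʳ q)))
    concat-ranges (suc l) = begin
      concatMap f (range 0 (suc l))                         ≡⟨ cong (concatMap f) (range-∷ʳ 0 l) ⟩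
      concatMap f (range 0 l ++ [ l ])                      ≡⟨ concatMap-++ f (range 0 l) [ l ] ⟩
      concatMap f (range 0 l) ++ f l ++ []                  ≡⟨ cong₂ _++_ (concat-ranges l) (++-identityʳ (f l)) ⟩
      range 0 (colStart l) ++ range (colStart l) (height l) ≡⟨ range-++ 0 (colStart l) (height l) ⟨
      range 0 (colStart l + height l)                       ≡⟨ cong (range 0) (colStart-suc l) ⟨
      range 0 (colStart (suc l))                            ∎
      where f = λ c → range (colStart c) (height c)

  rowMajor-cells : map rowMajor cells ↭ range 0 n
  rowMajor-cells = ↭.↭-trans (↭.↭-reflexive columns) (RowMajor.rowMajor-↭ m q r r≤m)
    where
    columns : map rowMajor cells ≡ concatMap (RowMajor.column m q r) (range 0 m)
    columns = trans (map-concatMap rowMajor column (range 0 m))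
                    (concatMap-cong (λ c → sym (map-∘ (range 0 (height c)))) (range 0 m))

  InGrid : ℕ × ℕ → Set
  InGrid a = Cell a × colMajor a < n × rowMajor a < n

  cells-InGrid : All InGrid cells
  cells-InGrid =
    All.zip (cells-Cell , All.zip (below colMajor (↭.↭-reflexive colMajor-cells) , below rowMajor rowMajor-cells))
    where
    below : ∀ f → map f cells ↭ range 0 n → All (λ a → f a < n) cells
    below f f-cells = All.map⁻ (↭.All-resp-↭ (↭.↭-sym f-cells) (range-All 0 n λ _ c<n → c<n))

  module Labelling {P} (P<q : P < q) (X Y : ℕ → ℕ) (X-close : Clustered n P X) (Y-close : Clustered n m Y) where

    label : ℕ × ℕ → ℕ × ℕ
    label a = X (colMajor a) , Y (rowMajor a)

    rows-apart : ∀ c {k k′} → k < k′ → c + k * m + m ≤ c + k′ * m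
    rows-apart c {k} {k′} k<k′ = begin
      c + k * m + m   ≡⟨ +-assoc c (k * m) m ⟩
      c + (k * m + m) ≡⟨ cong (c +_) (+-comm (k * m) m) ⟩
      c + suc k * m   ≤⟨ +-monoʳ-≤ c (*-monoˡ-≤ m k<k′) ⟩
      c + k′ * m      ∎
      where open ≤-Reasoning

    same-column : ∀ {c k k′} → c < m → k < k′ → c + k′ * m < n → Y (c + k * m) ≢ Y (c + k′ * m)
    same-column {c} c<m k<k′ bound eq = <⇒≱ (Y-close i<i′ bound eq) (rows-apart c k<k′)
      where i<i′ = <-≤-trans (m<m+n _ (≤-<-trans z≤n c<m)) (rows-apart c k<k′)

    distant-rows : ∀ {c c′ k k′} → c′ < m → 2 + k′ ≤ k → c + k * m < n → Y (c′ + k′ * m) ≢ Y (c + k * m)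
    distant-rows {c} {c′} {k} {k′} c′<m 2+k′≤k bound eq = <⇒≱ (Y-close i′<i bound eq) (<⇒≤ i′+m<i)
      where
      i′+m<i : c′ + k′ * m + m < c + k * m
      i′+m<i = begin-strict
        c′ + k′ * m + m <⟨ +-monoˡ-< m (+-monoˡ-< (k′ * m) c′<m) ⟩
        m + k′ * m + m  ≡⟨ +-comm (m + k′ * m) m ⟩
        (2 + k′) * m    ≤⟨ *-monoˡ-≤ m 2+k′≤k ⟩
        k * m           ≤⟨ m≤n+m (k * m) c ⟩
        c + k * m       ∎
        where open ≤-Reasoning
      i′<i = ≤-<-trans (m≤m+n _ m) i′+m<i

    near-rows : ∀ {c c′ k k′} → c < c′ → k < height c → k ≤ suc k′ → colStart c′ + k′ < n →
      X (colStart c + k) ≢ X (colStart c′ + k′)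
    near-rows {c} {c′} {k} {k′} c<c′ k<h k≤1+k′ bound eq = <⇒≱ (X-close t<t′ bound eq) t+P≤t′
      where
      t+P≤t′ : colStart c + k + P ≤ colStart c′ + k′
      t+P≤t′ = begin
        colStart c + k + P           ≡⟨ +-assoc (colStart c) k P ⟩
        colStart c + (k + P)         ≤⟨ +-monoʳ-≤ (colStart c) (+-monoˡ-≤ P k≤1+k′) ⟩
        colStart c + (suc k′ + P)    ≡⟨ cong (colStart c +_) (+-suc k′ P) ⟨
        colStart c + (k′ + suc P)    ≤⟨ +-monoʳ-≤ (colStart c) (+-monoʳ-≤ k′ (≤-trans P<q (m≤m+n q 𝟙[ c < r ]))) ⟩
        colStart c + (k′ + height c) ≡⟨ cong (colStart c +_) (+-comm k′ (height c)) ⟩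
        colStart c + (height c + k′) ≡⟨ +-assoc (colStart c) (height c) k′ ⟨
        colStart c + height c + k′   ≤⟨ +-monoˡ-≤ k′ (colStart-< c<c′) ⟩
        colStart c′ + k′             ∎
        where open ≤-Reasoning
      t<t′ : colStart c + k < colStart c′ + k′
      t<t′ = begin-strict
        colStart c + k        <⟨ +-monoʳ-< (colStart c) k<h ⟩
        colStart c + height c ≤⟨ colStart-< c<c′ ⟩
        colStart c′           ≤⟨ m≤m+n (colStart c′) k′ ⟩
        colStart c′ + k′      ∎
        where open ≤-Reasoning

    different-columns : ∀ {c c′ k k′} → c < c′ → InGrid (c , k) → InGrid (c′ , k′) →
      label (c , k) ≢ label (c′ , k′)
    different-columns {k = k} {k′} c<c′ ((_ , k<h) , _ , rm<n) ((c′<m , _) , cm′<n , _) eq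
      with 2 + k′ ≤? k
    ... | yes 2+k′≤k = distant-rows c′<m 2+k′≤k rm<n (sym (cong proj₂ eq))
    ... | no  k<2+k′ = near-rows c<c′ k<h (≤-pred (≰⇒> k<2+k′)) cm′<n (cong proj₁ eq)

    label-injective : ∀ {a b} → InGrid a → InGrid b → label a ≡ label b → a ≡ b
    label-injective {c , k} {c′ , k′} a@((c<m , _) , _ , rm<n) b@(_ , _ , rm′<n) eq with <-cmp c c′
    ... | tri< c<c′ _ _ = ⊥-elim (different-columns c<c′ a b eq)
    ... | tri> _ _ c′<c = ⊥-elim (different-columns c′<c b a (sym eq))
    ... | tri≈ _ refl _ with <-cmp k k′
    ...   | tri< k<k′ _ _ = ⊥-elim (same-column c<m k<k′ rm′<n (cong proj₂ eq))
    ...   | tri≈ _ refl _ = refl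
    ...   | tri> _ _ k′<k = ⊥-elim (same-column c<m k′<k rm<n (sym (cong proj₂ eq)))

    labels-unique : Unique (map label cells)
    labels-unique = map⁺-injectiveOn cells-InGrid label-injective
      (Unique.map⁻ (subst Unique (sym colMajor-cells) (range-unique 0 n)))

    labels-proj₁ : map proj₁ (map label cells) ≡ map X (range 0 n)
    labels-proj₁ = begin
      map proj₁ (map label cells) ≡⟨ map-∘ cells ⟨
      map (X ∘ colMajor) cells    ≡⟨ map-∘ cells ⟩
      map X (map colMajor cells)  ≡⟨ cong (map X) colMajor-cells ⟩
      map X (range 0 n)           ∎
      where open ≡-Reasoning

    labels-proj₂ : map proj₂ (map label cells) ↭ map Y (range 0 n)
    labels-proj₂ = begin
      map proj₂ (map label cells) ≡⟨ map-∘ cells ⟨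
      map (Y ∘ rowMajor) cells    ≡⟨ map-∘ cells ⟩
      map Y (map rowMajor cells)  ↭⟨ ↭.map⁺ Y rowMajor-cells ⟩
      map Y (range 0 n)           ∎
      where open ↭.PermutationReasoning

-- Distinct pairings

sort-Clustered : ∀ {xs B} → (∀ v → occ v xs ≤ B) → Clustered (length xs) B (nth (sort xs))
sort-Clustered {xs} occ≤B rewrite sym (↭.↭-length (sort-↭ xs)) =
  sorted-Clustered (Linked⇒AllPairs ≤-trans (sort-↗ xs))
                   (λ v → ≤-trans (≤-reflexive (occ-↭ v (sort-↭ xs))) (occ≤B v))

map-nth-sort : ∀ xs {n} → n ≡ length xs → map (nth (sort xs)) (range 0 n) ↭ xs
map-nth-sort xs refl rewrite sym (↭.↭-length (sort-↭ xs)) =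
  ↭.↭-trans (↭.↭-reflexive (map-nth-range (sort xs))) (sort-↭ xs)

distinct-pairing : ∀ P m .{{_ : NonZero m}} xs ys → length xs ≡ length ys →
  (∀ v → occ v xs ≤ P) → (∀ v → occ v ys ≤ m) → m * suc P ≤ length ys →
  ∃[ F ] (Unique F × map proj₁ F ↭ xs × map proj₂ F ↭ ys)
distinct-pairing P m xs ys length-≡ occ-xs occ-ys ys-large =
  map label cells , labels-unique ,
  ↭.↭-trans (↭.↭-reflexive labels-proj₁) (map-nth-sort xs (trans qm+r≡n (sym length-≡))) ,
  ↭.↭-trans labels-proj₂ (map-nth-sort ys qm+r≡n)
  where
  n = length ys
  q = n / m
  r = n % m
  qm+r≡n : q * m + r ≡ n
  qm+r≡n = trans (+-comm (q * m) r) (sym (m≡m%n+[m/n]*n n m))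
  P<q : P < q
  P<q = ≤-pred (*-cancelʳ-< m (suc P) (suc q) (begin-strict
    suc P * m ≡⟨ *-comm (suc P) m ⟩
    m * suc P ≤⟨ ys-large ⟩
    n         ≡⟨ qm+r≡n ⟨
    q * m + r <⟨ +-monoʳ-< (q * m) (m%n<n n m) ⟩
    q * m + m ≡⟨ +-comm (q * m) m ⟩
    suc q * m ∎))
    where open ≤-Reasoning
  open Grid m q r (<⇒≤ (m%n<n n m))
  open Labelling P<q (nth (sort xs)) (nth (sort ys))
    (subst (λ l → Clustered l P (nth (sort xs))) (trans length-≡ (sym qm+r≡n)) (sort-Clustered occ-xs))
    (subst (λ l → Clustered l m (nth (sort ys))) (sym qm+r≡n) (sort-Clustered occ-ys))

sum²-map : ∀ F → sum² F ≡ (sum (map proj₁ F) , sum (map proj₂ F))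
sum²-map []             = refl
sum²-map ((a , b) ∷ F) rewrite sum²-map F = refl

FS-pairing : ∀ {A B : Subset} {xs ys F} → All A xs → All B ys → Unique F → 1 ≤ length xs →
  map proj₁ F ↭ xs → map proj₂ F ↭ ys → FS (A ×ˢ B) (sum xs , sum ys)
FS-pairing {F = F} Axs Bys F! 1≤xs F₁↭ F₂↭ =
  F ,
  All.zip (All.map⁻ (↭.All-resp-↭ (↭-sym F₁↭) Axs) , All.map⁻ (↭.All-resp-↭ (↭-sym F₂↭) Bys)) ,
  F! ,
  ≤-trans 1≤xs (≤-reflexive (trans (sym (↭.↭-length F₁↭)) (length-map proj₁ F))) ,
  trans (sum²-map F) (cong₂ _,_ (sum-↭ F₁↭) (sum-↭ F₂↭))

FS-swap : ∀ {A B : Subset} {a b} → FS (A ×ˢ B) (a , b) → FS (B ×ˢ A) (b , a)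
FS-swap {a = a} {b} (F , AF , F! , 1≤F , sum≡) =
  map swap F ,
  All.map⁺ (All.map swap AF) ,
  Unique.map⁺ (cong swap) F! ,
  ≤-trans 1≤F (≤-reflexive (sym (length-map swap F))) ,
  (begin
    sum² (map swap F)                                             ≡⟨ sum²-map (map swap F) ⟩
    (sum (map proj₁ (map swap F)) , sum (map proj₂ (map swap F))) ≡⟨ cong₂ (λ u v → sum u , sum v) (map-∘ F) (map-∘ F) ⟨
    swap (sum (map proj₁ F) , sum (map proj₂ F))                  ≡⟨ cong swap (sum²-map F) ⟨
    swap (sum² F)                                                 ≡⟨ cong swap sum≡ ⟩
    (b , a)                                                       ∎)
  where open ≡-Reasoning

K+K≤4K² : ∀ K .{{_ : NonZero K}} → K + K ≤ 4 * (K * K)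
K+K≤4K² K = begin
  K + K       ≡⟨ cong (K +_) (+-identityʳ K) ⟨
  2 * K       ≤⟨ *-monoʳ-≤ 2 (m≤m*n K K) ⟩
  2 * (K * K) ≤⟨ *-monoˡ-≤ (K * K) {2} {4} (s≤s (s≤s z≤n)) ⟩
  4 * (K * K) ∎
  where open ≤-Reasoning

K[3K+1]≤4K² : ∀ K .{{_ : NonZero K}} → K * suc (2 * K + K) ≤ 4 * (K * K)
K[3K+1]≤4K² K = begin
  K * suc (2 * K + K) ≡⟨ solve 1 (λ k → k :* (con 1 :+ (con 2 :* k :+ k)) := k :+ con 3 :* (k :* k)) refl K ⟩
  K + 3 * (K * K)     ≤⟨ +-monoˡ-≤ (3 * (K * K)) (m≤m*n K K) ⟩
  K * K + 3 * (K * K) ≡⟨ solve 1 (λ k → k :* k :+ con 3 :* (k :* k) := con 4 :* (k :* k)) refl K ⟩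
  4 * (K * K)         ∎
  where
  open ≤-Reasoning
  open +-*-Solver

FS-lengthen-shorter : ∀ {A B : Subset} → Admissible A → ∀ K .{{_ : NonZero K}} {xs ys} →
  All A xs → All B ys → (∀ v → occ v xs ≤ K) → (∀ v → occ v ys ≤ K) →
  length xs ≤ length ys → ∣ length ys - length xs ∣ ≤ K → 4 * (K * K) ≤ length xs →
  FS (A ×ˢ B) (sum xs , sum ys)
FS-lengthen-shorter {A} {B} adm K {xs} {ys} Axs Bys occ-xs occ-ys xs≤ys ∣ys-xs∣≤K 4K²≤xs =
  let xs′ , Axs′ , sum′ , length′ , occ′ = Lengthen.lengthen (Admissible.cond-ii adm) d xs Axs room
      xs′≡ys = trans length′ (m∸n+n≡m xs≤ys)
      F , F! , F₁↭ , F₂↭ = distinct-pairing (2 * K + K) K xs′ ys xs′≡ys (occ-≤ xs′ occ′) occ-ys ys-large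
  in subst (λ s → FS (A ×ˢ B) (s , sum ys)) sum′ (FS-pairing Axs′ Bys F! (nonempty xs′≡ys) F₁↭ F₂↭)
  where
  d = length ys ∸ length xs
  d≤K : d ≤ K
  d≤K = subst (_≤ K) (m≤n⇒∣n-m∣≡n∸m xs≤ys) ∣ys-xs∣≤K
  room : occ 1 xs + d ≤ length xs
  room = ≤-trans (+-mono-≤ (occ-xs 1) d≤K) (≤-trans (K+K≤4K² K) 4K²≤xs)
  occ-≤ : ∀ xs′ → (∀ v → occ v xs′ ≤ 2 * d + occ v xs) → ∀ v → occ v xs′ ≤ 2 * K + K
  occ-≤ _ occ′ v = ≤-trans (occ′ v) (+-mono-≤ (*-monoʳ-≤ 2 d≤K) (occ-xs v))
  ys-large : K * suc (2 * K + K) ≤ length ys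
  ys-large = ≤-trans (K[3K+1]≤4K² K) (≤-trans 4K²≤xs xs≤ys)
  nonempty : ∀ {l} → l ≡ length ys → 1 ≤ l
  nonempty refl = ≤-trans (≤-trans (>-nonZero⁻¹ K) (m≤m+n K K)) (≤-trans (K+K≤4K² K) (≤-trans 4K²≤xs xs≤ys))

proposition4p1 : (A₁ A₂ : Subset) → Admissible A₁ → Admissible A₂ →
    (p₁ p₂ : ℕ) → 1 ≤ p₁ → 1 ≤ p₂ →
    (ε₁ ε₂ : List ℕ) → IsShortestRep A₁ p₁ ε₁ → IsShortestRep A₂ p₂ ε₂ →
    4 * ((mult ε₁ ⊔ mult ε₂ ⊔ ∣ repLength ε₁ - repLength ε₂ ∣)
         * (mult ε₁ ⊔ mult ε₂ ⊔ ∣ repLength ε₁ - repLength ε₂ ∣))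
      ≤ repLength ε₁ ⊓ repLength ε₂ →
    FS (A₁ ×ˢ A₂) (p₁ , p₂)
proposition4p1 A₁ A₂ adm₁ adm₂ _ _ 0<p₁ _ ε₁ ε₂ ((Aε₁ , refl) , _) ((Aε₂ , refl) , _) 4K²≤L =
  [ (λ ε₁≤ε₂ → FS-lengthen-shorter adm₁ K Aε₁ Aε₂ occ₁≤K occ₂≤K ε₁≤ε₂
                 (subst (_≤ K) (∣-∣-comm (length ε₁) (length ε₂)) gap≤K) (≤-trans 4K²≤L (m⊓n≤m _ _)))
  , (λ ε₂≤ε₁ → FS-swap (FS-lengthen-shorter adm₂ K Aε₂ Aε₁ occ₂≤K occ₁≤K ε₂≤ε₁
                 gap≤K (≤-trans 4K²≤L (m⊓n≤n _ _))))
  ]′ (≤-total (length ε₁) (length ε₂))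
  where
  K = mult ε₁ ⊔ mult ε₂ ⊔ ∣ length ε₁ - length ε₂ ∣
  gap≤K : ∣ length ε₁ - length ε₂ ∣ ≤ K
  gap≤K = m≤n⊔m _ _
  mult₁≤K : mult ε₁ ≤ K
  mult₁≤K = ≤-trans (m≤m⊔n (mult ε₁) (mult ε₂)) (m≤m⊔n _ _)
  occ₁≤K : ∀ v → occ v ε₁ ≤ K
  occ₁≤K v = ≤-trans (occ≤mult v ε₁) mult₁≤K
  occ₂≤K : ∀ v → occ v ε₂ ≤ K
  occ₂≤K v = ≤-trans (occ≤mult v ε₂) (≤-trans (m≤n⊔m (mult ε₁) (mult ε₂)) (m≤m⊔n _ _))
  instance
    K≢0 : NonZero K
    K≢0 = >-nonZero (≤-trans (mult-pos {ε₁} 0<p₁) mult₁≤K)
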